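{- For all positive integers $n$ and $k$ with $k\equiv1\pmod 3$, $$\det\left(M_{n+i+j}^{(k)}\right)_{0\le i,j\le k-1}=(-1)^{n\lfloor (k+1)/3\rfloor}\left(\frac{2k+4}{3}\right)^{n-1}.$$
   Context: $M_N^{(k)}$ denotes the number of lattice paths from $(0,0)$ to $(N,0)$ with steps $(1,1)$, $(1,0)$, $(1,-1)$ that never pass below the $x$-axis and never pass above the line $y=k$ (bounded Motzkin paths). -}

module Defs where

open import Data.Nat using (ℕ; zero; suc; _<ᵇ_)
open import Data.Bool using (Bool; true; false; _∧_)
open import Data.List using (List; []; _∷_; length; filter; map; concatMap; foldr; allFin)
open import Data.Fin using (Fin; toℕ; punchIn)
import Data.Fin as F
open import Data.Integer using (ℤ; +_; _*_; _+_; -_)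
open import Relation.Nullary.Decidable using (Dec)
open import Data.Bool using (T)
open import Data.Bool.Properties using (T?)

-- Motzkin steps (1,1), (1,0), (1,-1)
data Step : Set where
  U F D : Step

allPaths : ℕ → List (List Step)
allPaths zero = [] ∷ []
allPaths (suc N) = concatMap (λ p → (U ∷ p) ∷ (F ∷ p) ∷ (D ∷ p) ∷ []) (allPaths N)

valid : ℕ → ℕ → List Step → Bool
valid k h [] with h
... | zero = true
... | suc _ = false
valid k h (U ∷ p) = (h <ᵇ k) ∧ valid k (suc h) p
valid k h (F ∷ p) = valid k h p
valid k zero (D ∷ p) = false
valid k (suc h) (D ∷ p) = valid k h p

-- M k N = number of Motzkin paths (0,0) → (N,0) bounded by the line y = k
M : ℕ → ℕ → ℕ
M k N = length (filter (λ p → T? (valid k 0 p)) (allPaths N))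

sign : ℕ → ℤ
sign zero = + 1
sign (suc m) = - sign m

sumℤ : List ℤ → ℤ
sumℤ = foldr _+_ (+ 0)

det : (n : ℕ) → (Fin n → Fin n → ℤ) → ℤ
det zero A = + 1
det (suc n) A =
  sumℤ (map (λ j → sign (toℕ j) * (A F.zero j * det n (λ r c → A (F.suc r) (punchIn j c))))
            (allFin (suc n)))

-- The bounded Motzkin numbers are moments of the transfer matrix T of the strip
-- 0 ≤ y ≤ k, a (k + 1) × (k + 1) tridiagonal 0/1 matrix: M_N = (T^N)₀₀.  Writing
-- W_N(h) = (T^N)_{h0} for the number of walks from height h down to 0, the symmetry of
-- T gives M_{a+b} = Σ_h W_a(h) W_b(h).  The matrix (W_m(h))_{m,h<k} is unitriangular, so
-- row operations reduce det(M_{1+i+j}) to the k × k tridiagonal 0/1 determinant, whose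
-- values repeat 1, 1, 0, −1, −1, 0; for k = 3t + 1 it is (−1)^t.
-- The polynomials P_h with P_h(T) e₀ = e_h satisfy P_{k+1}(T) = 0, a linear recurrence
-- for M.  For k = 3t + 1, P_{k+1} has no constant term and linear coefficient −(2t + 2),
-- so the recurrence has order k: moving the last row of (M_{n+1+i+j}) to the front and
-- reducing it by the recurrence multiplies det(M_{n+i+j}) by (−1)^{k−1}(2t + 2), which
-- is (−1)^t (2k + 4)/3.

module Submission where

open import Defs

import Algebra.Properties.Semiring.Sum
open import Data.Bool using (Bool; true; false; if_then_else_; _∧_)
open import Data.Bool.Properties using (T-≡; T?; if-eta; if-cong-then)
open import Data.Empty using (⊥-elim)
open import Data.Fin using (Fin; zero; suc; toℕ; punchIn; inject₁)
open import Data.Fin.Properties using (toℕ<n; toℕ-inject₁; toℕ-fromℕ)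
open import Data.Integer using (ℤ; +_; _+_; _*_; -_; _-_; _^_)
open import Data.Integer.Properties
  using ( +-*-semiring; *-zeroˡ; *-zeroʳ; *-identityˡ; *-identityʳ; +-identityˡ; +-identityʳ; +-assoc; *-comm
        ; neg-involutive; neg-distribˡ-*; pos-+; pos-*)
open import Data.Integer.Tactic.RingSolver using (solve-∀)
open import Data.List using (List; []; _∷_; tabulate; concatMap; filter; length)
open import Data.List.Properties using (map-tabulate)
open import Data.Nat as ℕ using (ℕ; zero; suc; _/_; _%_; _≥_; _∸_; _<_; _≤_; _≡ᵇ_; _<ᵇ_; z≤n; s≤s; z<s; s<s)
open import Data.Nat.DivMod using (m≡m%n+[m/n]*n; +-distrib-/-∣ʳ; m*n/n≡m)
open import Data.Nat.Divisibility using (n∣m*n)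
import Data.Nat.Properties as ℕ
open import Data.Nat.Tactic.RingSolver using () renaming (solve-∀ to ℕ-solve-∀)
open import Data.Sum using (inj₁; inj₂)
open import Data.Vec.Functional using (zipWith)
open import Function using (_∘_; _$_; id; Equivalence)
open import Relation.Binary.Definitions using (tri<; tri≈; tri>)
open import Relation.Binary.PropositionalEquality
open import Relation.Nullary using (yes; no)

open Algebra.Properties.Semiring.Sum +-*-semiring
  using (sum; sum-syntax; sum-cong-≗; sum-replicate-zero; sum-init-last; ∑-distrib-+; ∑-comm; *-distribˡ-sum)

-- Finite sums

∑-zero : ∀ {n} (f : Fin n → ℤ) → (∀ i → f i ≡ + 0) → sum f ≡ + 0
∑-zero {n} f f≡0 = trans (sum-cong-≗ f≡0) (sum-replicate-zero n)

∑-linear : ∀ {n} (a b : ℤ) (f g : Fin n → ℤ) →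
  ∑[ i < n ] (a * f i + b * g i) ≡ a * sum f + b * sum g
∑-linear a b f g =
  trans (∑-distrib-+ (λ i → a * f i) (λ i → b * g i)) (sym (cong₂ _+_ (*-distribˡ-sum a f) (*-distribˡ-sum b g)))

∑-last : ∀ t (f : ℕ → ℤ) → ∑[ i < suc t ] (f (toℕ i)) ≡ ∑[ i < t ] (f (toℕ i)) + f t
∑-last t f = trans (sum-init-last {t} (f ∘ toℕ))
  (cong₂ _+_ (sum-cong-≗ {t} {f ∘ toℕ ∘ inject₁} (cong f ∘ toℕ-inject₁)) (cong f (toℕ-fromℕ t)))

∑-sub : ∀ {n} (f g : Fin n → ℤ) → ∑[ i < n ] (f i - g i) ≡ sum f - sum g
∑-sub {n} f g = begin
    ∑[ i < n ] (f i - g i)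
  ≡⟨ sum-cong-≗ {n} (λ i → as-combination (f i) (g i)) ⟩
    ∑[ i < n ] (+ 1 * f i + - + 1 * g i)
  ≡⟨ ∑-linear (+ 1) (- + 1) f g ⟩
    + 1 * sum f + - + 1 * sum g
  ≡⟨ as-combination (sum f) (sum g) ⟨
    sum f - sum g
  ∎
  where
  open ≡-Reasoning
  as-combination : ∀ a b → a - b ≡ + 1 * a + - + 1 * b
  as-combination = solve-∀

∑-pull : ∀ {n} (x y : ℤ) (f : Fin n → ℤ) → x * (y * sum f) ≡ ∑[ i < n ] (x * (y * f i))
∑-pull x y f = trans (cong (x *_) (*-distribˡ-sum y f)) (*-distribˡ-sum x (λ i → y * f i))

∑-vanishing-tail : ∀ t u (f : ℕ → ℤ) → t ≤ u → (∀ h → t ≤ h → h < u → f h ≡ + 0) →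
  ∑[ i < u ] (f (toℕ i)) ≡ ∑[ i < t ] (f (toℕ i))
∑-vanishing-tail t u f t≤u tail≡0 with ℕ.m≤n⇒m<n∨m≡n t≤u
... | inj₂ refl = refl
∑-vanishing-tail t (suc u) f _ tail≡0 | inj₁ (s≤s t≤u) = begin
    ∑[ i < suc u ] (f (toℕ i))
  ≡⟨ ∑-last u f ⟩
    ∑[ i < u ] (f (toℕ i)) + f u
  ≡⟨ cong₂ _+_ (∑-vanishing-tail t u f t≤u λ h t≤h h<u → tail≡0 h t≤h (ℕ.<-trans h<u (ℕ.n<1+n u)))
               (tail≡0 u t≤u (ℕ.n<1+n u)) ⟩
    ∑[ i < t ] (f (toℕ i)) + + 0
  ≡⟨ +-identityʳ _ ⟩
    ∑[ i < t ] (f (toℕ i))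
  ∎
  where open ≡-Reasoning

δ : ℕ → ℕ → ℤ
δ m n = if m ≡ᵇ n then + 1 else + 0

δ-≢ : ∀ m n → m ≢ n → δ m n ≡ + 0
δ-≢ zero zero m≢n = ⊥-elim (m≢n refl)
δ-≢ zero (suc n) _ = refl
δ-≢ (suc m) zero _ = refl
δ-≢ (suc m) (suc n) m≢n = δ-≢ m n (m≢n ∘ cong suc)

∑-δ : ∀ t (f : ℕ → ℤ) h → h < t → ∑[ g < t ] (f (toℕ g) * δ (toℕ g) h) ≡ f h
∑-δ (suc t) f zero _ = begin
    f 0 * + 1 + ∑[ g < t ] (f (suc (toℕ g)) * + 0)
  ≡⟨ cong₂ _+_ (*-identityʳ (f 0)) (∑-zero {t} _ (λ g → *-zeroʳ (f (suc (toℕ g))))) ⟩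
    f 0 + + 0
  ≡⟨ +-identityʳ (f 0) ⟩
    f 0
  ∎
  where open ≡-Reasoning
∑-δ (suc t) f (suc h) (s<s h<t) = begin
    f 0 * + 0 + ∑[ g < t ] (f (suc (toℕ g)) * δ (toℕ g) h)
  ≡⟨ cong₂ _+_ (*-zeroʳ (f 0)) (∑-δ t (f ∘ suc) h h<t) ⟩
    + 0 + f (suc h)
  ≡⟨ +-identityˡ (f (suc h)) ⟩
    f (suc h)
  ∎
  where open ≡-Reasoning

*-zeroʳ-≡ : ∀ x {y} → y ≡ + 0 → x * y ≡ + 0
*-zeroʳ-≡ x refl = *-zeroʳ x

-- Determinants

Matrix : ℕ → Set
Matrix n = Fin n → Fin n → ℤ

minor : ∀ {n} → Fin (suc n) → Matrix (suc n) → Matrix n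
minor j A r c = A (suc r) (punchIn j c)

colMinor : ∀ {n} → Fin (suc n) → Matrix (suc n) → Matrix n
colMinor i A r c = A (punchIn i r) (suc c)

sumℤ-tabulate : ∀ {n} (f : Fin n → ℤ) → sumℤ (tabulate f) ≡ sum f
sumℤ-tabulate {zero} f = refl
sumℤ-tabulate {suc n} f = cong (_+_ (f zero)) (sumℤ-tabulate (f ∘ suc))

det-expand : ∀ n (A : Matrix (suc n)) →
  det (suc n) A ≡ ∑[ j < suc n ] (sign (toℕ j) * (A zero j * det n (minor j A)))
det-expand n A = trans (cong sumℤ (map-tabulate id term)) (sumℤ-tabulate term)
  where
  term : Fin (suc n) → ℤ
  term j = sign (toℕ j) * (A zero j * det n (minor j A))

det-cong : ∀ n {A B : Matrix n} → (∀ i j → A i j ≡ B i j) → det n A ≡ det n B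
det-cong zero A≡B = refl
det-cong (suc n) {A} {B} A≡B = trans (det-expand n A) (trans (sum-cong-≗ term≡) (sym (det-expand n B)))
  where
  term≡ : ∀ j → sign (toℕ j) * (A zero j * det n (minor j A)) ≡ sign (toℕ j) * (B zero j * det n (minor j B))
  term≡ j = cong₂ (λ x d → sign (toℕ j) * (x * d)) (A≡B zero j) (det-cong n (λ r c → A≡B (suc r) (punchIn j c)))

-- Expanding along row 0 and then each minor along its column 0 gives a double sum over
-- the minors avoiding rows 0, i + 1 and columns 0, j + 1; swapping the two sums and
-- regrouping gives the expansion along column 0.
det-expand-col : ∀ n (A : Matrix (suc n)) →
  det (suc n) A ≡ ∑[ i < suc n ] (sign (toℕ i) * (A i zero * det n (colMinor i A)))
det-expand-col zero A = refl
det-expand-col (suc n) A = begin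
    det (suc (suc n)) A
  ≡⟨ det-expand (suc n) A ⟩
    corner + ∑[ j < suc n ] (- ε j * (row j * det (suc n) (minor (suc j) A)))
  ≡⟨ cong (_+_ corner) (sum-cong-≗ λ j → cong (λ d → - ε j * (row j * d)) (det-expand-col n (minor (suc j) A))) ⟩
    corner + ∑[ j < suc n ] (- ε j * (row j * ∑[ i < suc n ] (ε i * (col i * D₂ i j))))
  ≡⟨ cong (_+_ corner) (trans (sum-cong-≗ λ j → ∑-pull (- ε j) (row j) (λ i → ε i * (col i * D₂ i j)))
                              (∑-comm term)) ⟩
    corner + ∑[ i < suc n ] (∑[ j < suc n ] (term j i))
  ≡⟨ cong (_+_ corner) (sum-cong-≗ λ i → trans (sum-cong-≗ λ j → swap (ε j) (row j) (ε i) (col i) (D₂ i j))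
                                                 (sym (∑-pull (- ε i) (col i) (λ j → ε j * (row j * D₂ i j))))) ⟩
    corner + ∑[ i < suc n ] (- ε i * (col i * ∑[ j < suc n ] (ε j * (row j * D₂ i j))))
  ≡⟨ cong (_+_ corner) (sum-cong-≗ λ i → cong (λ d → - ε i * (col i * d)) (det-expand n (colMinor (suc i) A))) ⟨
    corner + ∑[ i < suc n ] (- ε i * (col i * det (suc n) (colMinor (suc i) A)))
  ∎
  where
  open ≡-Reasoning
  ε : Fin (suc n) → ℤ
  ε i = sign (toℕ i)
  row col : Fin (suc n) → ℤ
  row j = A zero (suc j)
  col i = A (suc i) zero
  corner : ℤ
  corner = + 1 * (A zero zero * det (suc n) (minor zero A))
  D₂ : Fin (suc n) → Fin (suc n) → ℤ
  D₂ i j = det n (λ r c → A (suc (punchIn i r)) (suc (punchIn j c)))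
  term : Fin (suc n) → Fin (suc n) → ℤ
  term j i = - ε j * (row j * (ε i * (col i * D₂ i j)))
  swap : ∀ s x s′ y d → - s * (x * (s′ * (y * d))) ≡ - s′ * (y * (s * (x * d)))
  swap = solve-∀

det-transpose : ∀ n (A : Matrix n) → det n (λ i j → A j i) ≡ det n A
det-transpose zero A = refl
det-transpose (suc n) A = begin
    det (suc n) (λ i j → A j i)
  ≡⟨ det-expand n (λ i j → A j i) ⟩
    ∑[ j < suc n ] (sign (toℕ j) * (A j zero * det n (λ r c → colMinor j A c r)))
  ≡⟨ sum-cong-≗ (λ j → cong (λ d → sign (toℕ j) * (A j zero * d)) (det-transpose n (colMinor j A))) ⟩
    ∑[ j < suc n ] (sign (toℕ j) * (A j zero * det n (colMinor j A)))
  ≡⟨ det-expand-col n A ⟨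
    det (suc n) A
  ∎
  where open ≡-Reasoning

det-rows01-equal : ∀ n (A : Matrix (suc (suc n))) → (∀ j → A zero j ≡ A (suc zero) j) →
  det (suc (suc n)) A ≡ + 0
det-rows01-equal n A rows≡ = begin
    det (suc (suc n)) A
  ≡⟨ det-expand-col (suc n) A ⟩
    + 1 * (A zero zero * det (suc n) (colMinor zero A))
      + (- + 1 * (A (suc zero) zero * det (suc n) (colMinor (suc zero) A)) + sum far)
  ≡⟨ cong₂ (λ x d → + 1 * t + (- + 1 * (x * d) + sum far)) (sym (rows≡ zero)) (det-cong (suc n) minors≡) ⟩
    + 1 * t + (- + 1 * t + sum far)
  ≡⟨ cong (λ s → + 1 * t + (- + 1 * t + s)) (∑-zero far (λ i → far≡0 n A rows≡ (sign (toℕ (suc (suc i)))) i)) ⟩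
    + 1 * t + (- + 1 * t + + 0)
  ≡⟨ cancel t ⟩
    + 0
  ∎
  where
  open ≡-Reasoning
  t : ℤ
  t = A zero zero * det (suc n) (colMinor zero A)
  far : Fin n → ℤ
  far i = sign (toℕ (suc (suc i))) * (A (suc (suc i)) zero * det (suc n) (colMinor (suc (suc i)) A))
  minors≡ : ∀ r c → colMinor (suc zero) A r c ≡ colMinor zero A r c
  minors≡ zero c = rows≡ (suc c)
  minors≡ (suc r) c = refl
  cancel : ∀ x → + 1 * x + (- + 1 * x + + 0) ≡ + 0
  cancel = solve-∀
  far≡0 : ∀ n (A : Matrix (suc (suc n))) → (∀ j → A zero j ≡ A (suc zero) j) → ∀ s i →
    s * (A (suc (suc i)) zero * det (suc n) (colMinor (suc (suc i)) A)) ≡ + 0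
  far≡0 (suc n) A rows≡ s i =
    *-zeroʳ-≡ s (*-zeroʳ-≡ (A (suc (suc i)) zero) (det-rows01-equal n (colMinor (suc (suc i)) A) (rows≡ ∘ suc)))

-- Row operations

-- A square matrix given by its rows, indexed by ℕ so that no Fin arithmetic is needed;
-- only the rows below n matter.
Rows : ℕ → Set
Rows n = ℕ → Fin n → ℤ

detRows : (n : ℕ) → Rows n → ℤ
detRows n R = det n (λ i → R (toℕ i))

minorRows : ∀ {n} → Fin (suc n) → Rows (suc n) → Rows n
minorRows j R m c = R (suc m) (punchIn j c)

detRows-cong : ∀ n {R S : Rows n} → (∀ m → m < n → R m ≗ S m) → detRows n R ≡ detRows n S
detRows-cong n R≡S = det-cong n (λ i → R≡S (toℕ i) (toℕ<n i))

expansionTerm : ∀ {n} → Rows (suc n) → Fin (suc n) → ℤ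
expansionTerm {n} R j = sign (toℕ j) * (R 0 j * detRows n (minorRows j R))

detRows-expand : ∀ n (R : Rows (suc n)) → detRows (suc n) R ≡ ∑[ j < suc n ] (expansionTerm R j)
detRows-expand n R = det-expand n (λ i → R (toℕ i))

detRows-termwise-linear : ∀ n (R₁ R₂ R : Rows (suc n)) (a b : ℤ) →
  (∀ j → expansionTerm R j ≡ a * expansionTerm R₁ j + b * expansionTerm R₂ j) →
  detRows (suc n) R ≡ a * detRows (suc n) R₁ + b * detRows (suc n) R₂
detRows-termwise-linear n R₁ R₂ R a b terms≡ = begin
    detRows (suc n) R
  ≡⟨ trans (detRows-expand n R) (sum-cong-≗ terms≡) ⟩
    ∑[ j < suc n ] (a * expansionTerm R₁ j + b * expansionTerm R₂ j)
  ≡⟨ ∑-linear a b (expansionTerm R₁) (expansionTerm R₂) ⟩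
    a * ∑[ j < suc n ] (expansionTerm R₁ j) + b * ∑[ j < suc n ] (expansionTerm R₂ j)
  ≡⟨ cong₂ (λ x y → a * x + b * y) (detRows-expand n R₁) (detRows-expand n R₂) ⟨
    a * detRows (suc n) R₁ + b * detRows (suc n) R₂
  ∎
  where open ≡-Reasoning

detRows-linear : ∀ n p → p < n → (R₁ R₂ R : Rows n) (a b : ℤ) →
  (∀ m → m ≢ p → R₁ m ≗ R m) → (∀ m → m ≢ p → R₂ m ≗ R m) →
  (∀ j → R p j ≡ a * R₁ p j + b * R₂ p j) →
  detRows n R ≡ a * detRows n R₁ + b * detRows n R₂
detRows-linear (suc n) zero _ R₁ R₂ R a b R₁≡R R₂≡R Rp≡ =
  detRows-termwise-linear n R₁ R₂ R a b λ j → begin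
      sign (toℕ j) * (R 0 j * detRows n (minorRows j R))
    ≡⟨ cong₂ (λ x d → sign (toℕ j) * (x * d)) (Rp≡ j)
         (detRows-cong n λ m _ c → sym (R₁≡R (suc m) (λ ()) (punchIn j c))) ⟩
      sign (toℕ j) * ((a * R₁ 0 j + b * R₂ 0 j) * d₁ j)
    ≡⟨ distribute (sign (toℕ j)) (R₁ 0 j) (R₂ 0 j) (d₁ j) a b ⟩
      a * (sign (toℕ j) * (R₁ 0 j * d₁ j)) + b * (sign (toℕ j) * (R₂ 0 j * d₁ j))
    ≡⟨ cong (λ d → a * expansionTerm R₁ j + b * (sign (toℕ j) * (R₂ 0 j * d)))
         (detRows-cong n λ m _ c → trans (R₁≡R (suc m) (λ ()) (punchIn j c)) (sym (R₂≡R (suc m) (λ ()) (punchIn j c)))) ⟩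
      a * expansionTerm R₁ j + b * expansionTerm R₂ j
    ∎
  where
  open ≡-Reasoning
  d₁ : Fin (suc n) → ℤ
  d₁ j = detRows n (minorRows j R₁)
  distribute : ∀ s x y d a b → s * ((a * x + b * y) * d) ≡ a * (s * (x * d)) + b * (s * (y * d))
  distribute = solve-∀
detRows-linear (suc n) (suc p) (s<s p<n) R₁ R₂ R a b R₁≡R R₂≡R Rp≡ =
  detRows-termwise-linear n R₁ R₂ R a b λ j → begin
      sign (toℕ j) * (R 0 j * detRows n (minorRows j R))
    ≡⟨ cong₂ (λ x d → sign (toℕ j) * (x * d)) (sym (R₁≡R 0 (λ ()) j))
         (detRows-linear n p p<n (minorRows j R₁) (minorRows j R₂) (minorRows j R) a b
           (λ m m≢p c → R₁≡R (suc m) (m≢p ∘ ℕ.suc-injective) (punchIn j c))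
           (λ m m≢p c → R₂≡R (suc m) (m≢p ∘ ℕ.suc-injective) (punchIn j c))
           (λ c → Rp≡ (punchIn j c))) ⟩
      sign (toℕ j) * (R₁ 0 j * (a * d₁ j + b * d₂ j))
    ≡⟨ distribute (sign (toℕ j)) (R₁ 0 j) (d₁ j) (d₂ j) a b ⟩
      a * expansionTerm R₁ j + b * (sign (toℕ j) * (R₁ 0 j * d₂ j))
    ≡⟨ cong (λ x → a * expansionTerm R₁ j + b * (sign (toℕ j) * (x * d₂ j)))
         (trans (R₁≡R 0 (λ ()) j) (sym (R₂≡R 0 (λ ()) j))) ⟩
      a * expansionTerm R₁ j + b * expansionTerm R₂ j
    ∎
  where
  open ≡-Reasoning
  d₁ d₂ : Fin (suc n) → ℤ
  d₁ j = detRows n (minorRows j R₁)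
  d₂ j = detRows n (minorRows j R₂)
  distribute : ∀ s x d₁ d₂ a b → s * (x * (a * d₁ + b * d₂)) ≡ a * (s * (x * d₁)) + b * (s * (x * d₂))
  distribute = solve-∀

detRows-adjacent-equal : ∀ n p → suc p < n → (R : Rows n) → R p ≗ R (suc p) → detRows n R ≡ + 0
detRows-adjacent-equal (suc (suc n)) zero _ R rows≡ = det-rows01-equal n (λ i → R (toℕ i)) rows≡
detRows-adjacent-equal (suc n) (suc p) (s<s p<n) R rows≡ =
  trans (detRows-expand n R) (∑-zero _ λ j → *-zeroʳ-≡ (sign (toℕ j)) $ *-zeroʳ-≡ (R 0 j) $
    (detRows-adjacent-equal n p p<n (minorRows j R) (λ c → rows≡ (punchIn j c))))

setRow : ∀ {n} → ℕ → (Fin n → ℤ) → Rows n → Rows n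
setRow p v R m with m ℕ.≟ p
... | yes _ = v
... | no _ = R m

setRow-≡ : ∀ {n} p v (R : Rows n) → setRow p v R p ≡ v
setRow-≡ p v R with p ℕ.≟ p
... | yes _ = refl
... | no p≢p = ⊥-elim (p≢p refl)

setRow-≢ : ∀ {n} {p m} v (R : Rows n) → m ≢ p → setRow p v R m ≡ R m
setRow-≢ {p = p} {m} v R m≢p with m ℕ.≟ p
... | yes m≡p = ⊥-elim (m≢p m≡p)
... | no _ = refl

setRow-congʳ : ∀ {n} p v {R S : Rows n} m → R m ≡ S m → setRow p v R m ≡ setRow p v S m
setRow-congʳ p v m Rm≡Sm with m ℕ.≟ p
... | yes _ = refl
... | no _ = Rm≡Sm

rows-≗-except : ∀ {n} p (R S : Rows n) → (∀ m → m ≢ p → R m ≗ S m) → R p ≗ S p → ∀ m → R m ≗ S m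
rows-≗-except p R S off on m with m ℕ.≟ p
... | yes refl = on
... | no m≢p = off m m≢p

rows-≗-except₂ : ∀ {n} p (R S : Rows n) → (∀ m → m ≢ p → m ≢ suc p → R m ≗ S m) →
  R p ≗ S p → R (suc p) ≗ S (suc p) → ∀ m → R m ≗ S m
rows-≗-except₂ p R S off onp onsp m with m ℕ.≟ p | m ℕ.≟ suc p
... | yes refl | _ = onp
... | no _ | yes refl = onsp
... | no m≢p | no m≢sp = off m m≢p m≢sp

detRows-additive : ∀ n p → p < n → (R₁ R₂ R : Rows n) →
  (∀ m → m ≢ p → R₁ m ≗ R m) → (∀ m → m ≢ p → R₂ m ≗ R m) →
  (∀ j → R p j ≡ R₁ p j + R₂ p j) → detRows n R ≡ detRows n R₁ + detRows n R₂
detRows-additive n p p<n R₁ R₂ R R₁≡R R₂≡R Rp≡ =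
  trans (detRows-linear n p p<n R₁ R₂ R (+ 1) (+ 1) R₁≡R R₂≡R (λ j → trans (Rp≡ j) (one+one (R₁ p j) (R₂ p j))))
        (sym (one+one (detRows n R₁) (detRows n R₂)))
  where
  one+one : ∀ a b → a + b ≡ + 1 * a + + 1 * b
  one+one = solve-∀

setAdjacent : ∀ {n} → ℕ → (Fin n → ℤ) → (Fin n → ℤ) → Rows n → Rows n
setAdjacent p u v R = setRow p u (setRow (suc p) v R)

setAdjacent-≡ : ∀ {n} p u v (R : Rows n) → setAdjacent p u v R p ≡ u
setAdjacent-≡ p u v R = setRow-≡ p u (setRow (suc p) v R)

setAdjacent-suc : ∀ {n} p u v (R : Rows n) → setAdjacent p u v R (suc p) ≡ v
setAdjacent-suc p u v R = trans (setRow-≢ u (setRow (suc p) v R) (ℕ.1+n≢n {p})) (setRow-≡ (suc p) v R)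

setAdjacent-≢ : ∀ {n} p u v (R : Rows n) m → m ≢ p → m ≢ suc p → setAdjacent p u v R m ≡ R m
setAdjacent-≢ p u v R m m≢p m≢sp = trans (setRow-≢ u (setRow (suc p) v R) m≢p) (setRow-≢ v R m≢sp)

detRows-setAdjacent-+ˡ : ∀ n p → suc p < n → (R : Rows n) (u u′ v : Fin n → ℤ) →
  detRows n (setAdjacent p (zipWith _+_ u u′) v R) ≡ detRows n (setAdjacent p u v R) + detRows n (setAdjacent p u′ v R)
detRows-setAdjacent-+ˡ n p sp<n R u u′ v = detRows-additive n p (ℕ.<-trans (ℕ.n<1+n p) sp<n) _ _ _
  (λ m m≢p j → cong (λ r → r j) (trans (setRow-≢ u _ m≢p) (sym (setRow-≢ (zipWith _+_ u u′) _ m≢p))))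
  (λ m m≢p j → cong (λ r → r j) (trans (setRow-≢ u′ _ m≢p) (sym (setRow-≢ (zipWith _+_ u u′) _ m≢p))))
  (λ j → cong (λ r → r j) (trans (setAdjacent-≡ p (zipWith _+_ u u′) v R)
                                 (sym (cong₂ (zipWith _+_) (setAdjacent-≡ p u v R) (setAdjacent-≡ p u′ v R)))))

detRows-setAdjacent-+ʳ : ∀ n p → suc p < n → (R : Rows n) (u v v′ : Fin n → ℤ) →
  detRows n (setAdjacent p u (zipWith _+_ v v′) R) ≡ detRows n (setAdjacent p u v R) + detRows n (setAdjacent p u v′ R)
detRows-setAdjacent-+ʳ n p sp<n R u v v′ = detRows-additive n (suc p) sp<n _ _ _
  (λ m m≢sp j → cong (λ r → r j)
    (setRow-congʳ p u m (trans (setRow-≢ v R m≢sp) (sym (setRow-≢ (zipWith _+_ v v′) R m≢sp)))))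
  (λ m m≢sp j → cong (λ r → r j)
    (setRow-congʳ p u m (trans (setRow-≢ v′ R m≢sp) (sym (setRow-≢ (zipWith _+_ v v′) R m≢sp)))))
  (λ j → cong (λ r → r j) (trans (setAdjacent-suc p u (zipWith _+_ v v′) R)
                                 (sym (cong₂ (zipWith _+_) (setAdjacent-suc p u v R) (setAdjacent-suc p u v′ R)))))

detRows-setAdjacent-diag : ∀ n p → suc p < n → (R : Rows n) (u : Fin n → ℤ) →
  detRows n (setAdjacent p u u R) ≡ + 0
detRows-setAdjacent-diag n p sp<n R u = detRows-adjacent-equal n p sp<n (setAdjacent p u u R)
  λ j → cong (λ r → r j) (trans (setAdjacent-≡ p u u R) (sym (setAdjacent-suc p u u R)))

-- Polarization: the determinant, bilinear and alternating in the rows p and p + 1,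
-- is antisymmetric in them.
detRows-swap-adjacent : ∀ n p → suc p < n → (R R′ : Rows n) →
  (∀ m → m ≢ p → m ≢ suc p → R′ m ≗ R m) → R′ p ≗ R (suc p) → R′ (suc p) ≗ R p →
  detRows n R′ ≡ - detRows n R
detRows-swap-adjacent n p sp<n R R′ R′≡R R′p R′sp = begin
    detRows n R′
  ≡⟨ detRows-cong n (λ m _ → rows-≗-except₂ p R′ (pairRows y x) R′-other
       (λ j → trans (R′p j) (sym (at y x j))) (λ j → trans (R′sp j) (sym (at-suc y x j))) m) ⟩
    Δ y x
  ≡⟨ isolate (Δ x x) (Δ x y) (Δ y x) (Δ y y) ⟩
    ((Δ x x + Δ x y) + (Δ y x + Δ y y)) - (Δ x x + Δ y y) - Δ x y
  ≡⟨ cong₂ (λ u v → u - v - Δ x y) (sym expand-sum) (cong₂ _+_ (diag x) (diag y)) ⟩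
    Δ (x ⊕ y) (x ⊕ y) - (+ 0 + + 0) - Δ x y
  ≡⟨ cong₂ (λ u v → u - (+ 0 + + 0) - v) (diag (x ⊕ y))
       (detRows-cong n (λ m _ → rows-≗-except₂ p (pairRows x y) R original-other (at x y) (at-suc x y) m)) ⟩
    + 0 - (+ 0 + + 0) - detRows n R
  ≡⟨ simplify (detRows n R) ⟩
    - detRows n R
  ∎
  where
  open ≡-Reasoning
  x y : Fin n → ℤ
  x = R p
  y = R (suc p)
  _⊕_ : (Fin n → ℤ) → (Fin n → ℤ) → Fin n → ℤ
  _⊕_ = zipWith _+_
  pairRows : (Fin n → ℤ) → (Fin n → ℤ) → Rows n
  pairRows u v = setAdjacent p u v R
  Δ : (Fin n → ℤ) → (Fin n → ℤ) → ℤ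
  Δ u v = detRows n (pairRows u v)
  at : ∀ u v → pairRows u v p ≗ u
  at u v j = cong (λ r → r j) (setAdjacent-≡ p u v R)
  at-suc : ∀ u v → pairRows u v (suc p) ≗ v
  at-suc u v j = cong (λ r → r j) (setAdjacent-suc p u v R)
  original-other : ∀ m → m ≢ p → m ≢ suc p → pairRows x y m ≗ R m
  original-other m m≢p m≢sp j = cong (λ r → r j) (setAdjacent-≢ p x y R m m≢p m≢sp)
  R′-other : ∀ m → m ≢ p → m ≢ suc p → R′ m ≗ pairRows y x m
  R′-other m m≢p m≢sp j = trans (R′≡R m m≢p m≢sp j) (sym (cong (λ r → r j) (setAdjacent-≢ p y x R m m≢p m≢sp)))
  diag : ∀ u → Δ u u ≡ + 0
  diag = detRows-setAdjacent-diag n p sp<n R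
  expand-sum : Δ (x ⊕ y) (x ⊕ y) ≡ (Δ x x + Δ x y) + (Δ y x + Δ y y)
  expand-sum = trans (detRows-setAdjacent-+ˡ n p sp<n R x y (x ⊕ y))
                     (cong₂ _+_ (detRows-setAdjacent-+ʳ n p sp<n R x x y) (detRows-setAdjacent-+ʳ n p sp<n R y x y))
  isolate : ∀ a b c d → c ≡ ((a + b) + (c + d)) - (a + d) - b
  isolate = solve-∀
  simplify : ∀ a → + 0 - (+ 0 + + 0) - a ≡ - a
  simplify = solve-∀

detRows-equal-rows : ∀ n p q → p < q → q < n → (R : Rows n) → R p ≗ R q → detRows n R ≡ + 0
detRows-equal-rows n p (suc q) p<sq sq<n R Rp≡Rsq with ℕ.m≤n⇒m<n∨m≡n (ℕ.≤-pred p<sq)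
... | inj₂ refl = detRows-adjacent-equal n p sq<n R Rp≡Rsq
... | inj₁ p<q = begin
    detRows n R
  ≡⟨ neg-involutive (detRows n R) ⟨
    - (- detRows n R)
  ≡⟨ cong -_ (detRows-swap-adjacent n q sq<n R R′ R′-other R′-q R′-sq) ⟨
    - detRows n R′
  ≡⟨ cong -_ (detRows-equal-rows n p q p<q (ℕ.<-trans (ℕ.n<1+n q) sq<n) R′ R′p≡R′q) ⟩
    + 0
  ∎
  where
  open ≡-Reasoning
  R′ : Rows n
  R′ = setAdjacent q (R (suc q)) (R q) R
  R′-q : R′ q ≗ R (suc q)
  R′-q j = cong (λ r → r j) (setAdjacent-≡ q (R (suc q)) (R q) R)
  R′-sq : R′ (suc q) ≗ R q
  R′-sq j = cong (λ r → r j) (setAdjacent-suc q (R (suc q)) (R q) R)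
  R′-other : ∀ m → m ≢ q → m ≢ suc q → R′ m ≗ R m
  R′-other m m≢q m≢sq j = cong (λ r → r j) (setAdjacent-≢ q (R (suc q)) (R q) R m m≢q m≢sq)
  R′p≡R′q : R′ p ≗ R′ q
  R′p≡R′q j = trans (R′-other p (ℕ.<⇒≢ p<q) (ℕ.<⇒≢ (ℕ.<-trans p<q (ℕ.n<1+n q))) j)
                    (trans (Rp≡Rsq j) (sym (R′-q j)))

detRows-repeated-row : ∀ n p q → p ≢ q → p < n → q < n → (R : Rows n) → R p ≗ R q → detRows n R ≡ + 0
detRows-repeated-row n p q p≢q p<n q<n R Rp≡Rq with ℕ.<-cmp p q
... | tri< p<q _ _ = detRows-equal-rows n p q p<q q<n R Rp≡Rq
... | tri≈ _ p≡q _ = ⊥-elim (p≢q p≡q)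
... | tri> _ _ q<p = detRows-equal-rows n q p q<p p<n R (sym ∘ Rp≡Rq)

detRows-add-row : ∀ n p q → p ≢ q → p < n → q < n → (R R′ : Rows n) (a : ℤ) →
  (∀ m → m ≢ p → R′ m ≗ R m) → (∀ j → R′ p j ≡ R p j + a * R q j) → detRows n R′ ≡ detRows n R
detRows-add-row n p q p≢q p<n q<n R R′ a R′≡R R′p≡ = begin
    detRows n R′
  ≡⟨ detRows-linear n p p<n R Rq R′ (+ 1) a
       (λ m m≢p j → sym (R′≡R m m≢p j))
       (λ m m≢p j → trans (cong (λ r → r j) (setRow-≢ (R q) R m≢p)) (sym (R′≡R m m≢p j)))
       (λ j → trans (R′p≡ j) (cong₂ (λ x y → x + a * y) (sym (*-identityˡ (R p j)))
                                  (cong (λ r → r j) (sym (setRow-≡ p (R q) R))))) ⟩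
    + 1 * detRows n R + a * detRows n Rq
  ≡⟨ cong (λ d → + 1 * detRows n R + a * d) (detRows-repeated-row n p q p≢q p<n q<n Rq Rq-repeats) ⟩
    + 1 * detRows n R + a * + 0
  ≡⟨ simplify (detRows n R) a ⟩
    detRows n R
  ∎
  where
  open ≡-Reasoning
  Rq : Rows n
  Rq = setRow p (R q) R
  Rq-repeats : Rq p ≗ Rq q
  Rq-repeats j = cong (λ r → r j) (trans (setRow-≡ p (R q) R) (sym (setRow-≢ (R q) R (p≢q ∘ sym))))
  simplify : ∀ d a → + 1 * d + a * + 0 ≡ d
  simplify = solve-∀

detRows-add-combination : ∀ n t p (ι : Fin t → ℕ) (c : Fin t → ℤ) →
  p < n → (∀ h → ι h ≢ p) → (∀ h → ι h < n) →
  (R R′ : Rows n) → (∀ m → m ≢ p → R′ m ≗ R m) →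
  (∀ j → R′ p j ≡ R p j + ∑[ h < t ] (c h * R (ι h) j)) → detRows n R′ ≡ detRows n R
detRows-add-combination n zero p ι c p<n ι≢p ι<n R R′ R′≡R R′p≡ =
  detRows-cong n λ m _ → rows-≗-except p R′ R R′≡R (λ j → trans (R′p≡ j) (+-identityʳ (R p j))) m
detRows-add-combination n (suc t) p ι c p<n ι≢p ι<n R R′ R′≡R R′p≡ =
  trans (detRows-add-combination n t p (ι ∘ suc) (c ∘ suc) p<n (ι≢p ∘ suc) (ι<n ∘ suc) R₁ R′ R′≡R₁ R′p≡R₁)
        (detRows-add-row n p (ι zero) (ι≢p zero ∘ sym) p<n (ι<n zero) R R₁ (c zero)
          (λ m m≢p j → cong (λ r → r j) (setRow-≢ first R m≢p)) (λ j → cong (λ r → r j) (setRow-≡ p first R)))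
  where
  first : Fin n → ℤ
  first j = R p j + c zero * R (ι zero) j
  R₁ : Rows n
  R₁ = setRow p first R
  R₁-other : ∀ m → m ≢ p → R₁ m ≡ R m
  R₁-other m = setRow-≢ first R
  R′≡R₁ : ∀ m → m ≢ p → R′ m ≗ R₁ m
  R′≡R₁ m m≢p j = trans (R′≡R m m≢p j) (sym (cong (λ r → r j) (R₁-other m m≢p)))
  R′p≡R₁ : ∀ j → R′ p j ≡ R₁ p j + ∑[ h < t ] (c (suc h) * R₁ (ι (suc h)) j)
  R′p≡R₁ j = trans (R′p≡ j) (trans (sym (+-assoc (R p j) _ _))
    (cong₂ _+_ (cong (λ r → r j) (sym (setRow-≡ p first R)))
               (sum-cong-≗ λ h → cong (λ r → c (suc h) * r j) (sym (R₁-other (ι (suc h)) (ι≢p (suc h)))))))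

detRows-unitriangular : ∀ n (R S : Rows n) (a : ℕ → ℕ → ℤ) →
  (∀ m → m < n → ∀ j → R m j ≡ S m j + ∑[ h < m ] (a m (toℕ h) * S (toℕ h) j)) →
  detRows n R ≡ detRows n S
detRows-unitriangular n R S a R≡ =
  trans (sym (mixed-det n ℕ.≤-refl)) (detRows-cong n λ m m<n j → cong (λ r → r j) (mixed-< m<n))
  where
  mixed : ℕ → Rows n
  mixed t m with m ℕ.<? t
  ... | yes _ = S m
  ... | no _ = R m
  mixed-< : ∀ {t m} → m < t → mixed t m ≡ S m
  mixed-< {t} {m} m<t with m ℕ.<? t
  ... | yes _ = refl
  ... | no m≮t = ⊥-elim (m≮t m<t)
  mixed-≥ : ∀ {t m} → t ≤ m → mixed t m ≡ R m
  mixed-≥ {t} {m} t≤m with m ℕ.<? t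
  ... | yes m<t = ⊥-elim (ℕ.<⇒≱ m<t t≤m)
  ... | no _ = refl
  mixed-det : ∀ t → t ≤ n → detRows n (mixed t) ≡ detRows n R
  mixed-det zero _ = detRows-cong n λ m _ j → cong (λ r → r j) (mixed-≥ {0} {m} z≤n)
  mixed-det (suc t) t<n = trans (sym step) (mixed-det t (ℕ.<⇒≤ t<n))
    where
    off : ∀ m → m ≢ t → mixed t m ≗ mixed (suc t) m
    off m m≢t j with ℕ.<-cmp m t
    ... | tri< m<t _ _ = cong (λ r → r j) (trans (mixed-< m<t) (sym (mixed-< (ℕ.<-trans m<t (ℕ.n<1+n t)))))
    ... | tri≈ _ m≡t _ = ⊥-elim (m≢t m≡t)
    ... | tri> _ _ t<m = cong (λ r → r j) (trans (mixed-≥ (ℕ.<⇒≤ t<m)) (sym (mixed-≥ t<m)))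
    on : ∀ j → mixed t t j ≡ mixed (suc t) t j + ∑[ h < t ] (a t (toℕ h) * mixed (suc t) (toℕ h) j)
    on j = trans (cong (λ r → r j) (mixed-≥ ℕ.≤-refl)) (trans (R≡ t t<n j)
      (cong₂ _+_ (cong (λ r → r j) (sym (mixed-< (ℕ.n<1+n t))))
        (sum-cong-≗ λ h → cong (λ r → a t (toℕ h) * r j) (sym (mixed-< (ℕ.<-trans (toℕ<n h) (ℕ.n<1+n t)))))))
    step : detRows n (mixed t) ≡ detRows n (mixed (suc t))
    step = detRows-add-combination n t t toℕ (a t ∘ toℕ) t<n (λ h → ℕ.<⇒≢ (toℕ<n h)) (λ h → ℕ.<-trans (toℕ<n h) t<n)
      (mixed (suc t)) (mixed t) off on

-- As R 0 = R (k + 1), the rows of R are those of R ∘ suc with the last one moved to the front,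
-- which takes k adjacent swaps.
detRows-rotate : ∀ k (R : Rows (suc k)) → R 0 ≗ R (suc k) →
  detRows (suc k) (R ∘ suc) ≡ sign k * detRows (suc k) R
detRows-rotate zero R R0≡R1 =
  trans (detRows-cong 1 {R ∘ suc} {R} λ { 0 _ j → sym (R0≡R1 j) ; (suc _) (s<s ()) _ })
        (sym (*-identityˡ (detRows 1 R)))
detRows-rotate (suc k) R R0≡Rk = begin
    detRows (suc (suc k)) (R ∘ suc)
  ≡⟨ detRows-expand (suc k) (R ∘ suc) ⟩
    ∑[ j < suc (suc k) ] (sign (toℕ j) * (R 1 j * detRows (suc k) (minorRows j Y ∘ suc)))
  ≡⟨ sum-cong-≗ (λ j → trans (cong (λ d → sign (toℕ j) * (R 1 j * d))
                                    (detRows-rotate k (minorRows j Y) (λ c → R0≡Rk (punchIn j c))))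
                              (reorder (sign (toℕ j)) (R 1 j) (sign k) (detRows (suc k) (minorRows j Y)))) ⟩
    ∑[ j < suc (suc k) ] (sign k * expansionTerm Y j)
  ≡⟨ trans (cong (sign k *_) (detRows-expand (suc k) Y)) (*-distribˡ-sum (sign k) (expansionTerm Y)) ⟨
    sign k * detRows (suc (suc k)) Y
  ≡⟨ cong (sign k *_) (detRows-swap-adjacent (suc (suc k)) 0 (s<s (s<s z≤n)) R Y Y-other (λ _ → refl) (λ _ → refl)) ⟩
    sign k * - detRows (suc (suc k)) R
  ≡⟨ move-neg (sign k) (detRows (suc (suc k)) R) ⟨
    sign (suc k) * detRows (suc (suc k)) R
  ∎
  where
  open ≡-Reasoning
  Y : Rows (suc (suc k))
  Y 0 = R 1
  Y 1 = R 0
  Y (suc (suc m)) = R (suc (suc m))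
  Y-other : ∀ m → m ≢ 0 → m ≢ 1 → Y m ≗ R m
  Y-other 0 m≢0 _ = ⊥-elim (m≢0 refl)
  Y-other 1 _ m≢1 = ⊥-elim (m≢1 refl)
  Y-other (suc (suc m)) _ _ _ = refl
  reorder : ∀ s x s′ d → s * (x * (s′ * d)) ≡ s′ * (s * (x * d))
  reorder = solve-∀
  move-neg : ∀ s d → (- s) * d ≡ s * (- d)
  move-neg = solve-∀

detRows-scale-first-row : ∀ n (R R′ : Rows (suc n)) (a : ℤ) → (∀ m → m ≢ 0 → R′ m ≗ R m) →
  (∀ j → R′ 0 j ≡ a * R 0 j) → detRows (suc n) R′ ≡ a * detRows (suc n) R
detRows-scale-first-row n R R′ a R′≡R R′0≡ =
  trans (detRows-linear (suc n) 0 z<s R R R′ a (+ 0)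
          (λ m m≢0 j → sym (R′≡R m m≢0 j)) (λ m m≢0 j → sym (R′≡R m m≢0 j))
          (λ j → trans (R′0≡ j) (add-zero a (R 0 j))))
        (sym (add-zero a (detRows (suc n) R)))
  where
  add-zero : ∀ a x → a * x ≡ a * x + + 0 * x
  add-zero = solve-∀

detRows-first-row-combination : ∀ n (R R′ : Rows (suc n)) (a : ℕ → ℤ) → (∀ m → m ≢ 0 → R′ m ≗ R m) →
  (∀ j → R′ 0 j ≡ ∑[ i < suc n ] (a (toℕ i) * R (toℕ i) j)) → detRows (suc n) R′ ≡ a 0 * detRows (suc n) R
detRows-first-row-combination n R R′ a R′≡R R′0≡ =
  trans (detRows-add-combination (suc n) n 0 (suc ∘ toℕ) (a ∘ suc ∘ toℕ) z<s (λ _ ()) (λ h → s<s (toℕ<n h))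
          R₀ R′ R′≡R₀ R′0≡)
        (detRows-scale-first-row n R R₀ (a 0) (λ { 0 0≢0 _ → ⊥-elim (0≢0 refl) ; (suc m) _ _ → refl }) (λ _ → refl))
  where
  R₀ : Rows (suc n)
  R₀ 0 j = a 0 * R 0 j
  R₀ (suc m) = R (suc m)
  R′≡R₀ : ∀ m → m ≢ 0 → R′ m ≗ R₀ m
  R′≡R₀ 0 0≢0 = ⊥-elim (0≢0 refl)
  R′≡R₀ (suc m) _ = R′≡R (suc m) (λ ())

-- Hankel determinants

hankel : ℕ → (ℕ → ℤ) → ℕ → ℤ
hankel K f n = det K (λ i j → f (n ℕ.+ toℕ i ℕ.+ toℕ j))

-- The last row of the shifted matrix is moved to the front and reduced by the recurrence.
hankel-step : ∀ k (f a : ℕ → ℤ) n →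
  (∀ j → f (n ℕ.+ suc k ℕ.+ j) ≡ ∑[ i < suc k ] (a (toℕ i) * f (n ℕ.+ toℕ i ℕ.+ j))) →
  hankel (suc k) f (suc n) ≡ sign k * (a 0 * hankel (suc k) f n)
hankel-step k f a n recurrence = begin
    hankel (suc k) f (suc n)
  ≡⟨ detRows-cong (suc k) (λ m _ j → cong (λ x → f (x ℕ.+ toℕ j)) (sym (ℕ.+-suc n m))) ⟩
    detRows (suc k) (R̃ ∘ suc)
  ≡⟨ detRows-rotate k R̃ (λ _ → refl) ⟩
    sign k * detRows (suc k) R̃
  ≡⟨ cong (sign k *_) (detRows-first-row-combination k R R̃ a R̃≡R (recurrence ∘ toℕ)) ⟩
    sign k * (a 0 * hankel (suc k) f n)
  ∎
  where
  open ≡-Reasoning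
  R : Rows (suc k)
  R m j = f (n ℕ.+ m ℕ.+ toℕ j)
  R̃ : Rows (suc k)
  R̃ 0 = R (suc k)
  R̃ (suc m) = R (suc m)
  R̃≡R : ∀ m → m ≢ 0 → R̃ m ≗ R m
  R̃≡R 0 0≢0 = ⊥-elim (0≢0 refl)
  R̃≡R (suc m) _ _ = refl

-- Bounded Motzkin paths and the transfer matrix

count : (List Step → Bool) → List (List Step) → ℕ
count Q xs = length (filter (λ p → T? (Q p)) xs)

𝟙 : Bool → ℕ
𝟙 true = 1
𝟙 false = 0

count-∷ : ∀ Q p ps → count Q (p ∷ ps) ≡ 𝟙 (Q p) ℕ.+ count Q ps
count-∷ Q p ps with Q p
... | true = refl
... | false = refl

count-false : ∀ ps → count (λ _ → false) ps ≡ 0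
count-false [] = refl
count-false (p ∷ ps) = count-false ps

extend : List Step → List (List Step)
extend p = (U ∷ p) ∷ (F ∷ p) ∷ (D ∷ p) ∷ []

count-extend : ∀ Q ps → count Q (concatMap extend ps)
  ≡ count (λ p → Q (U ∷ p)) ps ℕ.+ count (λ p → Q (F ∷ p)) ps ℕ.+ count (λ p → Q (D ∷ p)) ps
count-extend Q [] = refl
count-extend Q (p ∷ ps) = begin
    count Q ((U ∷ p) ∷ (F ∷ p) ∷ (D ∷ p) ∷ concatMap extend ps)
  ≡⟨ trans (count-∷ Q (U ∷ p) _)
      (cong (𝟙 (QU p) ℕ.+_) (trans (count-∷ Q (F ∷ p) _) (cong (𝟙 (QF p) ℕ.+_) (count-∷ Q (D ∷ p) _)))) ⟩
    𝟙 (QU p) ℕ.+ (𝟙 (QF p) ℕ.+ (𝟙 (QD p) ℕ.+ count Q (concatMap extend ps)))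
  ≡⟨ cong (λ c → 𝟙 (QU p) ℕ.+ (𝟙 (QF p) ℕ.+ (𝟙 (QD p) ℕ.+ c))) (count-extend Q ps) ⟩
    𝟙 (QU p) ℕ.+ (𝟙 (QF p) ℕ.+ (𝟙 (QD p) ℕ.+ (count QU ps ℕ.+ count QF ps ℕ.+ count QD ps)))
  ≡⟨ regroup (𝟙 (QU p)) (𝟙 (QF p)) (𝟙 (QD p)) (count QU ps) (count QF ps) (count QD ps) ⟩
    (𝟙 (QU p) ℕ.+ count QU ps) ℕ.+ (𝟙 (QF p) ℕ.+ count QF ps) ℕ.+ (𝟙 (QD p) ℕ.+ count QD ps)
  ≡⟨ cong₂ ℕ._+_ (cong₂ ℕ._+_ (count-∷ QU p ps) (count-∷ QF p ps)) (count-∷ QD p ps) ⟨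
    count QU (p ∷ ps) ℕ.+ count QF (p ∷ ps) ℕ.+ count QD (p ∷ ps)
  ∎
  where
  open ≡-Reasoning
  QU QF QD : List Step → Bool
  QU p = Q (U ∷ p)
  QF p = Q (F ∷ p)
  QD p = Q (D ∷ p)
  regroup : ∀ u f d a b c → u ℕ.+ (f ℕ.+ (d ℕ.+ (a ℕ.+ b ℕ.+ c))) ≡ (u ℕ.+ a) ℕ.+ (f ℕ.+ b) ℕ.+ (d ℕ.+ c)
  regroup = ℕ-solve-∀

shift : (ℕ → ℤ) → ℕ → ℤ
shift x zero = + 0
shift x (suc h) = x h

-- The transfer matrix of the strip 0 ≤ y ≤ k, acting on functions of the height.
transfer : ℕ → (ℕ → ℤ) → ℕ → ℤ
transfer k x h = (if h <ᵇ k then x (suc h) else + 0) + x h + shift x h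

walks : ℕ → ℕ → ℕ → ℤ
walks k zero h = δ h 0
walks k (suc N) = transfer k (walks k N)

transfer-cong : ∀ k {x y : ℕ → ℤ} → (∀ h → x h ≡ y h) → ∀ h → transfer k x h ≡ transfer k y h
transfer-cong k {x} {y} x≡y h = cong₂ _+_ (cong₂ _+_ (if-cong-then (h <ᵇ k) (x≡y (suc h))) (x≡y h)) (shift≡ h)
  where
  shift≡ : ∀ h → shift x h ≡ shift y h
  shift≡ zero = refl
  shift≡ (suc h) = x≡y h

count-valid : ∀ k N h → + count (valid k h) (allPaths N) ≡ walks k N h
count-valid k zero zero = refl
count-valid k zero (suc h) = refl
count-valid k (suc N) h = begin
    + count (valid k h) (concatMap extend (allPaths N))
  ≡⟨ cong +_ (count-extend (valid k h) (allPaths N)) ⟩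
    + count (λ p → valid k h (U ∷ p)) (allPaths N) + c h + + count (λ p → valid k h (D ∷ p)) (allPaths N)
  ≡⟨ cong₂ (λ u d → u + c h + d) (up (h <ᵇ k)) (down h) ⟩
    transfer k c h
  ≡⟨ transfer-cong k (count-valid k N) h ⟩
    walks k (suc N) h
  ∎
  where
  open ≡-Reasoning
  c : ℕ → ℤ
  c h = + count (valid k h) (allPaths N)
  up : ∀ b → + count (λ p → b ∧ valid k (suc h) p) (allPaths N) ≡ (if b then c (suc h) else + 0)
  up true = refl
  up false = cong +_ (count-false (allPaths N))
  down : ∀ h → + count (λ p → valid k h (D ∷ p)) (allPaths N) ≡ shift c h
  down zero = cong +_ (count-false (allPaths N))
  down (suc h) = refl

<ᵇ-true : ∀ {m n} → m < n → (m <ᵇ n) ≡ true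
<ᵇ-true m<n = Equivalence.to T-≡ (ℕ.<⇒<ᵇ m<n)

n<ᵇn : ∀ n → (n <ᵇ n) ≡ false
n<ᵇn zero = refl
n<ᵇn (suc n) = n<ᵇn n

walks-above : ∀ k N h → N < h → walks k N h ≡ + 0
walks-above k zero (suc h) _ = refl
walks-above k (suc N) (suc h) (s<s N<h) = begin
    (if suc h <ᵇ k then walks k N (suc (suc h)) else + 0) + walks k N (suc h) + walks k N h
  ≡⟨ cong₂ (λ u x → (if suc h <ᵇ k then u else + 0) + x + walks k N h)
       (walks-above k N (suc (suc h)) (ℕ.<-trans N<h (ℕ.<-trans (ℕ.n<1+n h) (ℕ.n<1+n (suc h)))))
       (walks-above k N (suc h) (ℕ.<-trans N<h (ℕ.n<1+n h))) ⟩
    (if suc h <ᵇ k then + 0 else + 0) + + 0 + walks k N h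
  ≡⟨ cong₂ (λ u x → u + + 0 + x) (if-eta (suc h <ᵇ k)) (walks-above k N h N<h) ⟩
    + 0
  ∎
  where open ≡-Reasoning

walks-diag : ∀ k N → walks k N N ≡ + 1
walks-diag k zero = refl
walks-diag k (suc N) = begin
    (if suc N <ᵇ k then walks k N (suc (suc N)) else + 0) + walks k N (suc N) + walks k N N
  ≡⟨ cong₂ (λ u x → (if suc N <ᵇ k then u else + 0) + x + walks k N N)
       (walks-above k N (suc (suc N)) (ℕ.<-trans (ℕ.n<1+n N) (ℕ.n<1+n (suc N)))) (walks-above k N (suc N) (ℕ.n<1+n N)) ⟩
    (if suc N <ᵇ k then + 0 else + 0) + + 0 + walks k N N
  ≡⟨ cong₂ (λ u x → u + + 0 + x) (if-eta (suc N <ᵇ k)) (walks-diag k N) ⟩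
    + 1
  ∎
  where open ≡-Reasoning

pairing : ℕ → (ℕ → ℤ) → (ℕ → ℤ) → ℤ
pairing k x y = ∑[ h < suc k ] (x (toℕ h) * y (toℕ h))

pairing-comm : ∀ k (x y : ℕ → ℤ) → pairing k x y ≡ pairing k y x
pairing-comm k x y = sum-cong-≗ {suc k} λ h → *-comm (x (toℕ h)) (y (toℕ h))

shiftedPairing : ℕ → (ℕ → ℤ) → (ℕ → ℤ) → ℤ
shiftedPairing k x y = ∑[ h < k ] (x (suc (toℕ h)) * y (toℕ h))

transfer-pairing : ∀ k (x y : ℕ → ℤ) →
  pairing k (transfer k x) y ≡ shiftedPairing k x y + pairing k x y + shiftedPairing k y x
transfer-pairing k x y = begin
    pairing k (transfer k x) y
  ≡⟨ sum-cong-≗ {suc k} (λ h → distrib (up (toℕ h)) (x (toℕ h)) (shift x (toℕ h)) (y (toℕ h))) ⟩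
    ∑[ h < suc k ] (up-y (toℕ h) + x (toℕ h) * y (toℕ h) + down-y (toℕ h))
  ≡⟨ trans (∑-distrib-+ {suc k} (λ h → up-y (toℕ h) + x (toℕ h) * y (toℕ h)) (down-y ∘ toℕ))
           (cong (_+ sum {suc k} (down-y ∘ toℕ)) (∑-distrib-+ {suc k} (up-y ∘ toℕ) (λ h → x (toℕ h) * y (toℕ h)))) ⟩
    ∑[ h < suc k ] (up-y (toℕ h)) + pairing k x y + ∑[ h < suc k ] (down-y (toℕ h))
  ≡⟨ cong₂ (λ u d → u + pairing k x y + d) steps-down steps-up ⟩
    shiftedPairing k x y + pairing k x y + shiftedPairing k y x
  ∎
  where
  open ≡-Reasoning
  up up-y down-y : ℕ → ℤ
  up h = if h <ᵇ k then x (suc h) else + 0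
  up-y h = up h * y h
  down-y h = shift x h * y h
  distrib : ∀ u x s y → (u + x + s) * y ≡ u * y + x * y + s * y
  distrib = solve-∀
  steps-down : ∑[ h < suc k ] (up-y (toℕ h)) ≡ shiftedPairing k x y
  steps-down = begin
      ∑[ h < suc k ] (up-y (toℕ h))
    ≡⟨ ∑-last k up-y ⟩
      ∑[ h < k ] (up-y (toℕ h)) + up k * y k
    ≡⟨ cong₂ _+_ (sum-cong-≗ {k} λ h → cong (λ b → (if b then x (suc (toℕ h)) else + 0) * y (toℕ h)) (<ᵇ-true (toℕ<n h)))
                 (cong (λ b → (if b then x (suc k) else + 0) * y k) (n<ᵇn k)) ⟩
      shiftedPairing k x y + + 0 * y k
    ≡⟨ trans (cong (_+_ (shiftedPairing k x y)) (*-zeroˡ (y k))) (+-identityʳ _) ⟩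
      shiftedPairing k x y
    ∎
  steps-up : ∑[ h < suc k ] (down-y (toℕ h)) ≡ shiftedPairing k y x
  steps-up = trans (cong (_+ ∑[ h < k ] (x (toℕ h) * y (suc (toℕ h)))) (*-zeroˡ (y 0)))
                   (trans (+-identityˡ _) (sum-cong-≗ {k} λ h → *-comm (x (toℕ h)) (y (suc (toℕ h)))))

transfer-symmetric : ∀ k (x y : ℕ → ℤ) → pairing k (transfer k x) y ≡ pairing k x (transfer k y)
transfer-symmetric k x y = begin
    pairing k (transfer k x) y
  ≡⟨ transfer-pairing k x y ⟩
    shiftedPairing k x y + pairing k x y + shiftedPairing k y x
  ≡⟨ cong (λ s → shiftedPairing k x y + s + shiftedPairing k y x) (pairing-comm k x y) ⟩
    shiftedPairing k x y + pairing k y x + shiftedPairing k y x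
  ≡⟨ swap-ends (shiftedPairing k x y) (pairing k y x) (shiftedPairing k y x) ⟩
    shiftedPairing k y x + pairing k y x + shiftedPairing k x y
  ≡⟨ transfer-pairing k y x ⟨
    pairing k (transfer k y) x
  ≡⟨ pairing-comm k (transfer k y) x ⟩
    pairing k x (transfer k y)
  ∎
  where
  open ≡-Reasoning
  swap-ends : ∀ a b c → a + b + c ≡ c + b + a
  swap-ends = solve-∀

-- Each step moves from the first walk to the second by the symmetry of the transfer matrix.
M-pairing : ∀ k a b → + M k (a ℕ.+ b) ≡ pairing k (walks k a) (walks k b)
M-pairing k zero b = begin
    + M k b
  ≡⟨ count-valid k b 0 ⟩
    walks k b 0
  ≡⟨ trans (+-identityʳ _) (*-identityˡ _) ⟨
    + 1 * walks k b 0 + + 0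
  ≡⟨ cong (_+_ (+ 1 * walks k b 0)) (∑-zero {k} _ (λ h → *-zeroˡ (walks k b (suc (toℕ h))))) ⟨
    pairing k (walks k 0) (walks k b)
  ∎
  where open ≡-Reasoning
M-pairing k (suc a) b = begin
    + M k (suc a ℕ.+ b)
  ≡⟨ cong (+_ ∘ M k) (ℕ.+-suc a b) ⟨
    + M k (a ℕ.+ suc b)
  ≡⟨ M-pairing k a (suc b) ⟩
    pairing k (walks k a) (transfer k (walks k b))
  ≡⟨ transfer-symmetric k (walks k a) (walks k b) ⟨
    pairing k (walks k (suc a)) (walks k b)
  ∎
  where open ≡-Reasoning

-- The rows (walks k m h)_h, m < k, form a unitriangular matrix.
detRows-walks-combination : ∀ k (R X : Rows k) →
  (∀ m → m < k → ∀ j → R m j ≡ pairing k (walks k m) (λ h → X h j)) → detRows k R ≡ detRows k X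
detRows-walks-combination k R X R≡ = detRows-unitriangular k R X (walks k) λ m m<k j → begin
    R m j
  ≡⟨ R≡ m m<k j ⟩
    pairing k (walks k m) (λ h → X h j)
  ≡⟨ ∑-vanishing-tail (suc m) (suc k) (λ h → walks k m h * X h j) (s≤s (ℕ.<⇒≤ m<k))
       (λ h m<h _ → trans (cong (_* X h j) (walks-above k m h m<h)) (*-zeroˡ (X h j))) ⟩
    ∑[ h < suc m ] (walks k m (toℕ h) * X (toℕ h) j)
  ≡⟨ ∑-last m (λ h → walks k m h * X h j) ⟩
    ∑[ h < m ] (walks k m (toℕ h) * X (toℕ h) j) + walks k m m * X m j
  ≡⟨ cong (λ w → ∑[ h < m ] (walks k m (toℕ h) * X (toℕ h) j) + w * X m j) (walks-diag k m) ⟩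
    ∑[ h < m ] (walks k m (toℕ h) * X (toℕ h) j) + + 1 * X m j
  ≡⟨ +-comm-identity _ (X m j) ⟩
    X m j + ∑[ h < m ] (walks k m (toℕ h) * X (toℕ h) j)
  ∎
  where
  open ≡-Reasoning
  +-comm-identity : ∀ s x → s + + 1 * x ≡ x + s
  +-comm-identity = solve-∀

-- The tridiagonal determinant

band : ℕ → ℕ → ℤ
band zero zero = + 1
band zero (suc h) = δ h 0
band (suc g) zero = δ g 0
band (suc g) (suc h) = band g h

band-δ : ∀ g h → band g h ≡ δ (suc g) h + δ g h + shift (λ h′ → δ h′ h) g
band-δ zero zero = refl
band-δ zero (suc zero) = refl
band-δ zero (suc (suc h)) = refl
band-δ (suc zero) zero = refl
band-δ (suc (suc g)) zero = refl
band-δ (suc g) (suc h) = trans (band-δ g h) (cong (_+_ (δ (suc g) h + δ g h)) (shift-δ g))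
  where
  shift-δ : ∀ g → shift (λ h′ → δ h′ h) g ≡ δ g (suc h)
  shift-δ zero = refl
  shift-δ (suc g) = refl

transfer-δ : ∀ k g h → g ≤ k → h < k → transfer k (λ h′ → δ h′ h) g ≡ band g h
transfer-δ k g h g≤k h<k with ℕ.m≤n⇒m<n∨m≡n g≤k
... | inj₁ g<k = trans (cong (λ b → (if b then δ (suc g) h else + 0) + δ g h + shift (λ h′ → δ h′ h) g) (<ᵇ-true g<k))
                       (sym (band-δ g h))
... | inj₂ refl = begin
    (if g <ᵇ g then δ (suc g) h else + 0) + δ g h + shift (λ h′ → δ h′ h) g
  ≡⟨ cong (λ b → (if b then δ (suc g) h else + 0) + δ g h + shift (λ h′ → δ h′ h) g) (n<ᵇn g) ⟩
    + 0 + δ g h + shift (λ h′ → δ h′ h) g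
  ≡⟨ cong (λ d → d + δ g h + shift (λ h′ → δ h′ h) g) (δ-≢ (suc g) h sg≢h) ⟨
    δ (suc g) h + δ g h + shift (λ h′ → δ h′ h) g
  ≡⟨ band-δ g h ⟨
    band g h
  ∎
  where
  open ≡-Reasoning
  sg≢h : suc g ≢ h
  sg≢h sg≡h = ℕ.<⇒≱ h<k (subst (_ ≤_) sg≡h (ℕ.n≤1+n _))

transfer-band : ∀ k (x : ℕ → ℤ) h → h < k → transfer k x h ≡ pairing k x (λ g → band g h)
transfer-band k x h h<k = begin
    transfer k x h
  ≡⟨ ∑-δ (suc k) (transfer k x) h (ℕ.<-trans h<k (ℕ.n<1+n k)) ⟨
    pairing k (transfer k x) (λ g → δ g h)
  ≡⟨ transfer-symmetric k x (λ g → δ g h) ⟩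
    pairing k x (transfer k (λ g → δ g h))
  ≡⟨ sum-cong-≗ {suc k} (λ g → cong (x (toℕ g) *_) (transfer-δ k (toℕ g) h (ℕ.≤-pred (toℕ<n g)) h<k)) ⟩
    pairing k x (λ g → band g h)
  ∎
  where open ≡-Reasoning

bandMatrix : ∀ n → Matrix n
bandMatrix n i j = band (toℕ i) (toℕ j)

bandDet : ℕ → ℤ
bandDet n = det n (bandMatrix n)

bandDet-rec : ∀ n → bandDet (suc (suc n)) ≡ bandDet (suc n) - bandDet n
bandDet-rec n = begin
    bandDet (suc (suc n))
  ≡⟨ det-expand (suc n) B ⟩
    + 1 * (+ 1 * bandDet (suc n)) + (- + 1 * (+ 1 * det (suc n) (minor (suc zero) B)) + ∑[ j < n ] (sign (2 ℕ.+ toℕ j) * + 0))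
  ≡⟨ cong₂ (λ d r → + 1 * (+ 1 * bandDet (suc n)) + (- + 1 * (+ 1 * d) + r))
       second-minor (∑-zero {n} _ λ j → *-zeroʳ (sign (2 ℕ.+ toℕ j))) ⟩
    + 1 * (+ 1 * bandDet (suc n)) + (- + 1 * (+ 1 * bandDet n) + + 0)
  ≡⟨ simplify (bandDet (suc n)) (bandDet n) ⟩
    bandDet (suc n) - bandDet n
  ∎
  where
  open ≡-Reasoning
  B : Matrix (suc (suc n))
  B = bandMatrix (suc (suc n))
  second-minor : det (suc n) (minor (suc zero) B) ≡ bandDet n
  second-minor = begin
      det (suc n) (minor (suc zero) B)
    ≡⟨ det-expand-col n (minor (suc zero) B) ⟩
      + 1 * (+ 1 * bandDet n) + ∑[ i < n ] (- sign (toℕ i) * + 0)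
    ≡⟨ cong (_+_ (+ 1 * (+ 1 * bandDet n))) (∑-zero {n} _ λ i → *-zeroʳ (- sign (toℕ i))) ⟩
      + 1 * (+ 1 * bandDet n) + + 0
    ≡⟨ trans (+-identityʳ _) (trans (*-identityˡ _) (*-identityˡ _)) ⟩
      bandDet n
    ∎
  simplify : ∀ a b → + 1 * (+ 1 * a) + (- + 1 * (+ 1 * b) + + 0) ≡ a - b
  simplify = solve-∀

bandDet-antiperiodic : ∀ n → bandDet (3 ℕ.+ n) ≡ - bandDet n
bandDet-antiperiodic n = begin
    bandDet (3 ℕ.+ n)
  ≡⟨ bandDet-rec (suc n) ⟩
    bandDet (2 ℕ.+ n) - bandDet (suc n)
  ≡⟨ cong (_- bandDet (suc n)) (bandDet-rec n) ⟩
    bandDet (suc n) - bandDet n - bandDet (suc n)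
  ≡⟨ cancel (bandDet (suc n)) (bandDet n) ⟩
    - bandDet n
  ∎
  where
  open ≡-Reasoning
  cancel : ∀ a b → a - b - a ≡ - b
  cancel = solve-∀

bandDet-3t+1 : ∀ t → bandDet (suc (t ℕ.* 3)) ≡ sign t
bandDet-3t+1 zero = refl
bandDet-3t+1 (suc t) = trans (bandDet-antiperiodic (suc (t ℕ.* 3))) (cong -_ (bandDet-3t+1 t))

-- The recurrence for bounded Motzkin numbers

-- charPoly h i is the coefficient of x^i in P_h, where P₀ = 1, P₁ = x − 1 and
-- P_{h+2} = (x − 1) P_{h+1} − P_h.
charPoly : ℕ → ℕ → ℤ
charPoly zero i = δ i 0
charPoly (suc zero) i = δ i 1 - δ i 0
charPoly (suc (suc h)) i = shift (charPoly (suc h)) i - charPoly (suc h) i - charPoly h i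

charPoly-vanishes : ∀ h i → h < i → charPoly h i ≡ + 0
charPoly-vanishes zero (suc i) _ = refl
charPoly-vanishes (suc zero) (suc zero) (s<s ())
charPoly-vanishes (suc zero) (suc (suc i)) _ = refl
charPoly-vanishes (suc (suc h)) (suc i) (s<s h<i) =
  trans (cong₂ (λ a b → a - b - charPoly h (suc i))
           (charPoly-vanishes (suc h) i h<i) (charPoly-vanishes (suc h) (suc i) (ℕ.<-trans h<i (ℕ.n<1+n i))))
        (cong (λ c → + 0 - + 0 - c) (charPoly-vanishes h (suc i) (ℕ.<-trans (ℕ.n<1+n h) (ℕ.<-trans h<i (ℕ.n<1+n i)))))

charPoly-monic : ∀ h → charPoly h h ≡ + 1
charPoly-monic zero = refl
charPoly-monic (suc zero) = refl
charPoly-monic (suc (suc h)) =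
  trans (cong₂ (λ a b → a - b - charPoly h (suc (suc h)))
           (charPoly-monic (suc h)) (charPoly-vanishes (suc h) (suc (suc h)) (ℕ.n<1+n (suc h))))
        (cong (λ c → + 1 - + 0 - c) (charPoly-vanishes h (suc (suc h)) (ℕ.<-trans (ℕ.n<1+n h) (ℕ.n<1+n (suc h)))))

charPolyM : ℕ → ℕ → ℕ → ℤ
charPolyM k h N = ∑[ i < suc (suc k) ] (charPoly h (toℕ i) * + M k (N ℕ.+ toℕ i))

charPolyM-rec : ∀ k h N → suc h ≤ k →
  charPolyM k (suc (suc h)) N ≡ charPolyM k (suc h) (suc N) - charPolyM k (suc h) N - charPolyM k h N
charPolyM-rec k h N sh≤k = begin
    charPolyM k (suc (suc h)) N
  ≡⟨ sum-cong-≗ {suc (suc k)} (λ i → distrib (shift P (toℕ i)) (P (toℕ i)) (Q (toℕ i)) (m (toℕ i))) ⟩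
    ∑[ i < suc (suc k) ] (xPm (toℕ i) - Pm (toℕ i) - Qm (toℕ i))
  ≡⟨ trans (∑-sub {suc (suc k)} (λ i → xPm (toℕ i) - Pm (toℕ i)) (Qm ∘ toℕ))
           (cong (_- charPolyM k h N) (∑-sub {suc (suc k)} (xPm ∘ toℕ) (Pm ∘ toℕ))) ⟩
    ∑[ i < suc (suc k) ] (xPm (toℕ i)) - charPolyM k (suc h) N - charPolyM k h N
  ≡⟨ cong (λ s → s - charPolyM k (suc h) N - charPolyM k h N) shifted ⟩
    charPolyM k (suc h) (suc N) - charPolyM k (suc h) N - charPolyM k h N
  ∎
  where
  open ≡-Reasoning
  P Q m xPm Pm Qm Pm′ : ℕ → ℤ
  P = charPoly (suc h)
  Q = charPoly h
  m i = + M k (N ℕ.+ i)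
  xPm i = shift P i * m i
  Pm i = P i * m i
  Qm i = Q i * m i
  Pm′ i = P i * + M k (suc N ℕ.+ i)
  distrib : ∀ s p q x → (s - p - q) * x ≡ s * x - p * x - q * x
  distrib = solve-∀
  shifted : ∑[ i < suc (suc k) ] (xPm (toℕ i)) ≡ charPolyM k (suc h) (suc N)
  shifted = begin
      + 0 + ∑[ i < suc k ] (P (toℕ i) * m (suc (toℕ i)))
    ≡⟨ +-identityˡ _ ⟩
      ∑[ i < suc k ] (P (toℕ i) * m (suc (toℕ i)))
    ≡⟨ sum-cong-≗ {suc k} (λ i → cong (λ n → P (toℕ i) * + M k n) (ℕ.+-suc N (toℕ i))) ⟩
      ∑[ i < suc k ] (Pm′ (toℕ i))
    ≡⟨ +-identityʳ _ ⟨
      ∑[ i < suc k ] (Pm′ (toℕ i)) + + 0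
    ≡⟨ cong (λ c → ∑[ i < suc k ] (Pm′ (toℕ i)) + c * + M k (suc N ℕ.+ suc k))
            (charPoly-vanishes (suc h) (suc k) (s≤s sh≤k)) ⟨
      ∑[ i < suc k ] (Pm′ (toℕ i)) + Pm′ (suc k)
    ≡⟨ ∑-last (suc k) Pm′ ⟨
      charPolyM k (suc h) (suc N)
    ∎

walks-rec : ∀ k N h → suc h < k →
  walks k N (suc (suc h)) ≡ walks k (suc N) (suc h) - walks k N (suc h) - walks k N h
walks-rec k N h sh<k = begin
    walks k N (suc (suc h))
  ≡⟨ cancel (walks k N (suc (suc h))) (walks k N (suc h)) (walks k N h) ⟩
    walks k N (suc (suc h)) + walks k N (suc h) + walks k N h - walks k N (suc h) - walks k N h
  ≡⟨ cong (λ b → (if b then walks k N (suc (suc h)) else + 0) + walks k N (suc h) + walks k N h - walks k N (suc h) - walks k N h)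
         (<ᵇ-true sh<k) ⟨
    walks k (suc N) (suc h) - walks k N (suc h) - walks k N h
  ∎
  where
  open ≡-Reasoning
  cancel : ∀ a b c → a ≡ a + b + c - b - c
  cancel = solve-∀

charPolyM-walks : ∀ k h → h ≤ k → ∀ N → charPolyM k h N ≡ walks k N h
charPolyM-walks k zero _ N = begin
    + 1 * + M k (N ℕ.+ 0) + ∑[ i < suc k ] (+ 0 * + M k (N ℕ.+ suc (toℕ i)))
  ≡⟨ cong₂ _+_ (*-identityˡ (+ M k (N ℕ.+ 0))) (∑-zero {suc k} _ λ i → *-zeroˡ (+ M k (N ℕ.+ suc (toℕ i)))) ⟩
    + M k (N ℕ.+ 0) + + 0
  ≡⟨ trans (+-identityʳ _) (cong (+_ ∘ M k) (ℕ.+-identityʳ N)) ⟩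
    + M k N
  ≡⟨ count-valid k N 0 ⟩
    walks k N 0
  ∎
  where open ≡-Reasoning
charPolyM-walks (suc k) (suc zero) _ N = begin
    (+ 0 - + 1) * m 0 + ((+ 1 - + 0) * m 1 + ∑[ i < suc k ] ((+ 0 - + 0) * m (suc (suc (toℕ i)))))
  ≡⟨ cong (λ s → (+ 0 - + 1) * m 0 + ((+ 1 - + 0) * m 1 + s)) (∑-zero {suc k} _ λ i → *-zeroˡ (m (suc (suc (toℕ i))))) ⟩
    (+ 0 - + 1) * m 0 + ((+ 1 - + 0) * m 1 + + 0)
  ≡⟨ simplify (m 0) (m 1) ⟩
    m 1 - m 0
  ≡⟨ cong₂ _-_ (trans (cong (+_ ∘ M (suc k)) (ℕ.+-comm N 1)) (count-valid (suc k) (suc N) 0))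
               (trans (cong (+_ ∘ M (suc k)) (ℕ.+-identityʳ N)) (count-valid (suc k) N 0)) ⟩
    walks (suc k) N 1 + walks (suc k) N 0 + + 0 - walks (suc k) N 0
  ≡⟨ cancel (walks (suc k) N 1) (walks (suc k) N 0) ⟩
    walks (suc k) N 1
  ∎
  where
  open ≡-Reasoning
  m : ℕ → ℤ
  m i = + M (suc k) (N ℕ.+ i)
  simplify : ∀ a b → (+ 0 - + 1) * a + ((+ 1 - + 0) * b + + 0) ≡ b - a
  simplify = solve-∀
  cancel : ∀ a b → a + b + + 0 - b ≡ a
  cancel = solve-∀
charPolyM-walks k (suc (suc h)) ssh≤k N = begin
    charPolyM k (suc (suc h)) N
  ≡⟨ charPolyM-rec k h N sh≤k ⟩
    charPolyM k (suc h) (suc N) - charPolyM k (suc h) N - charPolyM k h N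
  ≡⟨ cong₂ (λ a b → a - b - charPolyM k h N) (charPolyM-walks k (suc h) sh≤k (suc N)) (charPolyM-walks k (suc h) sh≤k N) ⟩
    walks k (suc N) (suc h) - walks k N (suc h) - charPolyM k h N
  ≡⟨ cong (λ c → walks k (suc N) (suc h) - walks k N (suc h) - c) (charPolyM-walks k h h≤k N) ⟩
    walks k (suc N) (suc h) - walks k N (suc h) - walks k N h
  ≡⟨ walks-rec k N h ssh≤k ⟨
    walks k N (suc (suc h))
  ∎
  where
  open ≡-Reasoning
  sh≤k : suc h ≤ k
  sh≤k = ℕ.<⇒≤ ssh≤k
  h≤k : h ≤ k
  h≤k = ℕ.<⇒≤ sh≤k

charPolyM-top : ∀ k N → charPolyM (suc k) (suc (suc k)) N ≡ + 0
charPolyM-top k N = begin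
    charPolyM K (suc K) N
  ≡⟨ charPolyM-rec K k N ℕ.≤-refl ⟩
    charPolyM K K (suc N) - charPolyM K K N - charPolyM K k N
  ≡⟨ cong₂ (λ a b → a - b - charPolyM K k N) (charPolyM-walks K K ℕ.≤-refl (suc N)) (charPolyM-walks K K ℕ.≤-refl N) ⟩
    walks K (suc N) K - walks K N K - charPolyM K k N
  ≡⟨ cong (λ c → walks K (suc N) K - walks K N K - c) (charPolyM-walks K k (ℕ.n≤1+n k) N) ⟩
    (if K <ᵇ K then walks K N (suc K) else + 0) + walks K N K + walks K N k - walks K N K - walks K N k
  ≡⟨ cong (λ b → (if b then walks K N (suc K) else + 0) + walks K N K + walks K N k - walks K N K - walks K N k) (n<ᵇn K) ⟩
    + 0 + walks K N K + walks K N k - walks K N K - walks K N k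
  ≡⟨ cancel (walks K N K) (walks K N k) ⟩
    + 0
  ∎
  where
  open ≡-Reasoning
  K : ℕ
  K = suc k
  cancel : ∀ a b → + 0 + a + b - a - b ≡ + 0
  cancel = solve-∀

M-recurrence : ∀ k → charPoly (suc (suc k)) 0 ≡ + 0 → ∀ N →
  + M (suc k) (N ℕ.+ suc (suc k))
    ≡ ∑[ i < suc k ] (- charPoly (suc (suc k)) (suc (toℕ i)) * + M (suc k) (N ℕ.+ suc (toℕ i)))
M-recurrence k P₀≡0 N = begin
    m (suc K)
  ≡⟨ isolate (P 0 * m 0) lower (m (suc K)) ⟩
    P 0 * m 0 + (lower + + 1 * m (suc K)) - P 0 * m 0 - lower
  ≡⟨ cong (λ c → P 0 * m 0 + (lower + c * m (suc K)) - P 0 * m 0 - lower) (charPoly-monic (suc K)) ⟨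
    P 0 * m 0 + (lower + P (suc K) * m (suc K)) - P 0 * m 0 - lower
  ≡⟨ cong (λ s → P 0 * m 0 + s - P 0 * m 0 - lower) (∑-last K (λ i → P (suc i) * m (suc i))) ⟨
    charPolyM K (suc K) N - P 0 * m 0 - lower
  ≡⟨ cong₂ (λ a b → a - b * m 0 - lower) (charPolyM-top k N) P₀≡0 ⟩
    + 0 - + 0 * m 0 - lower
  ≡⟨ negate (m 0) lower ⟩
    - + 1 * lower
  ≡⟨ trans (*-distribˡ-sum {K} (- + 1) (λ i → P (suc (toℕ i)) * m (suc (toℕ i))))
           (sum-cong-≗ {K} λ i → neg-first (P (suc (toℕ i))) (m (suc (toℕ i)))) ⟩
    ∑[ i < K ] (- P (suc (toℕ i)) * m (suc (toℕ i)))
  ∎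
  where
  open ≡-Reasoning
  K : ℕ
  K = suc k
  P m : ℕ → ℤ
  P = charPoly (suc K)
  m i = + M K (N ℕ.+ i)
  lower : ℤ
  lower = ∑[ i < K ] (P (suc (toℕ i)) * m (suc (toℕ i)))
  isolate : ∀ a s x → x ≡ a + (s + + 1 * x) - a - s
  isolate = solve-∀
  negate : ∀ x s → + 0 - + 0 * x - s ≡ - + 1 * s
  negate = solve-∀
  neg-first : ∀ p x → - + 1 * (p * x) ≡ - p * x
  neg-first = solve-∀

-- The case k = 3t + 1

sub₃-cong : ∀ {a b c a′ b′ c′ : ℤ} → a ≡ a′ → b ≡ b′ → c ≡ c′ → a - b - c ≡ a′ - b′ - c′
sub₃-cong refl refl refl = refl

record LowCoefficients (t : ℕ) : Set where
  field
    P[3t]-const : charPoly (t ℕ.* 3) 0 ≡ + 1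
    P[3t]-linear : charPoly (t ℕ.* 3) 1 ≡ + t
    P[3t+1]-const : charPoly (suc (t ℕ.* 3)) 0 ≡ - + 1
    P[3t+1]-linear : charPoly (suc (t ℕ.* 3)) 1 ≡ + 1 + + t
    P[3t+2]-const : charPoly (suc (suc (t ℕ.* 3))) 0 ≡ + 0
    P[3t+2]-linear : charPoly (suc (suc (t ℕ.* 3))) 1 ≡ - (+ 2 * + t + + 2)

lowCoefficients : ∀ t → LowCoefficients t
lowCoefficients zero = record
  { P[3t]-const = refl ; P[3t]-linear = refl
  ; P[3t+1]-const = refl ; P[3t+1]-linear = refl
  ; P[3t+2]-const = refl ; P[3t+2]-linear = refl }
lowCoefficients (suc t) = record
  { P[3t]-const = P[3t+3]-const ; P[3t]-linear = P[3t+3]-linear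
  ; P[3t+1]-const = P[3t+4]-const ; P[3t+1]-linear = P[3t+4]-linear
  ; P[3t+2]-const = cong₂ (λ b c → + 0 - b - c) P[3t+4]-const P[3t+3]-const
  ; P[3t+2]-linear = trans (sub₃-cong P[3t+4]-const P[3t+4]-linear P[3t+3]-linear) (linear-rec₂ (+ t)) }
  where
  linear-rec₀ : ∀ t → + 0 - - (+ 2 * t + + 2) - (+ 1 + t) ≡ + 1 + t
  linear-rec₀ = solve-∀
  linear-rec₁ : ∀ t → + 1 - (+ 1 + t) - - (+ 2 * t + + 2) ≡ + 1 + (+ 1 + t)
  linear-rec₁ = solve-∀
  linear-rec₂ : ∀ t → - + 1 - (+ 1 + (+ 1 + t)) - (+ 1 + t) ≡ - (+ 2 * (+ 1 + t) + + 2)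
  linear-rec₂ = solve-∀
  open LowCoefficients (lowCoefficients t)
  P[3t+3]-const : charPoly (3 ℕ.+ t ℕ.* 3) 0 ≡ + 1
  P[3t+3]-const = cong₂ (λ b c → + 0 - b - c) P[3t+2]-const P[3t+1]-const
  P[3t+3]-linear : charPoly (3 ℕ.+ t ℕ.* 3) 1 ≡ + 1 + + t
  P[3t+3]-linear = trans (sub₃-cong P[3t+2]-const P[3t+2]-linear P[3t+1]-linear) (linear-rec₀ (+ t))
  P[3t+4]-const : charPoly (4 ℕ.+ t ℕ.* 3) 0 ≡ - + 1
  P[3t+4]-const = cong₂ (λ b c → + 0 - b - c) P[3t+3]-const P[3t+2]-const
  P[3t+4]-linear : charPoly (4 ℕ.+ t ℕ.* 3) 1 ≡ + 1 + (+ 1 + + t)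
  P[3t+4]-linear = trans (sub₃-cong P[3t+3]-const P[3t+3]-linear P[3t+2]-linear) (linear-rec₁ (+ t))

hankel-M-1 : ∀ k → hankel k (λ N → + M k N) 1 ≡ bandDet k
hankel-M-1 k = begin
    detRows k (λ m j → + M k (suc m ℕ.+ toℕ j))
  ≡⟨ detRows-walks-combination k _ (λ h j → walks k (suc (toℕ j)) h)
       (λ m _ j → trans (cong (+_ ∘ M k) (sym (ℕ.+-suc m (toℕ j)))) (M-pairing k m (suc (toℕ j)))) ⟩
    det k (λ i j → walks k (suc (toℕ j)) (toℕ i))
  ≡⟨ det-transpose k (λ i j → walks k (suc (toℕ i)) (toℕ j)) ⟩
    detRows k (λ m j → walks k (suc m) (toℕ j))
  ≡⟨ detRows-walks-combination k _ (λ g j → band g (toℕ j)) (λ m _ j → transfer-band k (walks k m) (toℕ j) (toℕ<n j)) ⟩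
    bandDet k
  ∎
  where open ≡-Reasoning

sign-+ : ∀ a b → sign (a ℕ.+ b) ≡ sign a * sign b
sign-+ zero b = sym (*-identityˡ (sign b))
sign-+ (suc a) b = trans (cong -_ (sign-+ a b)) (neg-distribˡ-* (sign a) (sign b))

sign-*3 : ∀ t → sign (t ℕ.* 3) ≡ sign t
sign-*3 zero = refl
sign-*3 (suc t) = trans (cong -_ (neg-involutive (sign (t ℕ.* 3)))) (cong -_ (sign-*3 t))

hankel-M-step : ∀ t n → let K = suc (t ℕ.* 3) in
  hankel K (λ N → + M K N) (suc (suc n)) ≡ sign t * ((+ 2 * + t + + 2) * hankel K (λ N → + M K N) (suc n))
hankel-M-step t n = begin
    hankel K f (suc (suc n))
  ≡⟨ hankel-step (t ℕ.* 3) f a (suc n) recurrence ⟩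
    sign (t ℕ.* 3) * (a 0 * hankel K f (suc n))
  ≡⟨ cong₂ (λ s x → s * (x * hankel K f (suc n))) (sign-*3 t)
       (trans (cong -_ (LowCoefficients.P[3t+2]-linear (lowCoefficients t))) (neg-involutive _)) ⟩
    sign t * ((+ 2 * + t + + 2) * hankel K f (suc n))
  ∎
  where
  open ≡-Reasoning
  K : ℕ
  K = suc (t ℕ.* 3)
  f a : ℕ → ℤ
  f N = + M K N
  a i = - charPoly (suc K) (suc i)
  recurrence : ∀ j → f (suc n ℕ.+ K ℕ.+ j) ≡ ∑[ i < K ] (a (toℕ i) * f (suc n ℕ.+ toℕ i ℕ.+ j))
  recurrence j = begin
      f (suc n ℕ.+ K ℕ.+ j)
    ≡⟨ cong f (shuffle₁ n (t ℕ.* 3) j) ⟩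
      f (n ℕ.+ j ℕ.+ suc K)
    ≡⟨ M-recurrence (t ℕ.* 3) (LowCoefficients.P[3t+2]-const (lowCoefficients t)) (n ℕ.+ j) ⟩
      ∑[ i < K ] (a (toℕ i) * f (n ℕ.+ j ℕ.+ suc (toℕ i)))
    ≡⟨ sum-cong-≗ {K} (λ i → cong (λ N → a (toℕ i) * f N) (shuffle₂ n j (toℕ i))) ⟩
      ∑[ i < K ] (a (toℕ i) * f (suc n ℕ.+ toℕ i ℕ.+ j))
    ∎
    where
    shuffle₁ : ∀ n k j → suc n ℕ.+ suc k ℕ.+ j ≡ n ℕ.+ j ℕ.+ suc (suc k)
    shuffle₁ = ℕ-solve-∀
    shuffle₂ : ∀ n j i → n ℕ.+ j ℕ.+ suc i ≡ suc n ℕ.+ i ℕ.+ j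
    shuffle₂ = ℕ-solve-∀

hankel-M : ∀ t n → let K = suc (t ℕ.* 3) in
  hankel K (λ N → + M K N) (suc n) ≡ sign (suc n ℕ.* t) * (+ 2 * + t + + 2) ^ n
hankel-M t zero = trans (hankel-M-1 (suc (t ℕ.* 3)))
  (trans (bandDet-3t+1 t) (sym (trans (*-identityʳ _) (cong sign (ℕ.+-identityʳ t)))))
hankel-M t (suc n) = begin
    hankel K f (suc (suc n))
  ≡⟨ hankel-M-step t n ⟩
    sign t * (x * hankel K f (suc n))
  ≡⟨ cong (λ d → sign t * (x * d)) (hankel-M t n) ⟩
    sign t * (x * (sign (suc n ℕ.* t) * x ^ n))
  ≡⟨ regroup (sign t) x (sign (suc n ℕ.* t)) (x ^ n) ⟩
    sign t * sign (suc n ℕ.* t) * (x * x ^ n)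
  ≡⟨ cong (_* (x * x ^ n)) (sign-+ t (suc n ℕ.* t)) ⟨
    sign (suc (suc n) ℕ.* t) * x ^ suc n
  ∎
  where
  open ≡-Reasoning
  K : ℕ
  K = suc (t ℕ.* 3)
  f : ℕ → ℤ
  f N = + M K N
  x : ℤ
  x = + 2 * + t + + 2
  regroup : ∀ s x s′ p → s * (x * (s′ * p)) ≡ s * s′ * (x * p)
  regroup = solve-∀

k≡1+[k/3]*3 : ∀ k → k % 3 ≡ 1 → k ≡ suc (k / 3 ℕ.* 3)
k≡1+[k/3]*3 k k%3≡1 = trans (m≡m%n+[m/n]*n k 3) (cong (ℕ._+ k / 3 ℕ.* 3) k%3≡1)

[k+1]/3≡t : ∀ t → (suc (t ℕ.* 3) ℕ.+ 1) / 3 ≡ t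
[k+1]/3≡t t = begin
    (suc (t ℕ.* 3) ℕ.+ 1) / 3
  ≡⟨ cong (_/ 3) (ℕ.+-comm (suc (t ℕ.* 3)) 1) ⟩
    (2 ℕ.+ t ℕ.* 3) / 3
  ≡⟨ +-distrib-/-∣ʳ 2 {d = 3} (n∣m*n t) ⟩
    2 / 3 ℕ.+ t ℕ.* 3 / 3
  ≡⟨ m*n/n≡m t 3 ⟩
    t
  ∎
  where open ≡-Reasoning

[2k+4]/3≡2t+2 : ∀ t → (2 ℕ.* suc (t ℕ.* 3) ℕ.+ 4) / 3 ≡ 2 ℕ.* t ℕ.+ 2
[2k+4]/3≡2t+2 t = trans (cong (_/ 3) (factor t)) (m*n/n≡m (2 ℕ.* t ℕ.+ 2) 3)
  where
  factor : ∀ t → 2 ℕ.* suc (t ℕ.* 3) ℕ.+ 4 ≡ (2 ℕ.* t ℕ.+ 2) ℕ.* 3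
  factor = ℕ-solve-∀

theorem54 : (n k : ℕ) → n ≥ 1 → k ≥ 1 → k % 3 ≡ 1 →
    det k (λ i j → + M k (n ℕ.+ toℕ i ℕ.+ toℕ j))
      ≡ sign (n ℕ.* ((k ℕ.+ 1) / 3)) * ((+ ((2 ℕ.* k ℕ.+ 4) / 3)) ^ (n ∸ 1))
theorem54 (suc n) k _ _ k%3≡1 = subst Goal (sym (k≡1+[k/3]*3 k k%3≡1)) (begin
    hankel K (λ N → + M K N) (suc n)
  ≡⟨ hankel-M t n ⟩
    sign (suc n ℕ.* t) * (+ 2 * + t + + 2) ^ n
  ≡⟨ cong (λ x → sign (suc n ℕ.* t) * x ^ n) (trans (pos-+ (2 ℕ.* t) 2) (cong (_+ + 2) (pos-* 2 t))) ⟨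
    sign (suc n ℕ.* t) * (+ (2 ℕ.* t ℕ.+ 2)) ^ n
  ≡⟨ cong₂ (λ u x → sign (suc n ℕ.* u) * (+ x) ^ n) ([k+1]/3≡t t) ([2k+4]/3≡2t+2 t) ⟨
    sign (suc n ℕ.* ((K ℕ.+ 1) / 3)) * (+ ((2 ℕ.* K ℕ.+ 4) / 3)) ^ n
  ∎)
  where
  open ≡-Reasoning
  t K : ℕ
  t = k / 3
  K = suc (t ℕ.* 3)
  Goal : ℕ → Set
  Goal k = det k (λ i j → + M k (suc n ℕ.+ toℕ i ℕ.+ toℕ j))
    ≡ sign (suc n ℕ.* ((k ℕ.+ 1) / 3)) * ((+ ((2 ℕ.* k ℕ.+ 4) / 3)) ^ (suc n ∸ 1))
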